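{- Let $x$ and $y$ be representations of a countable set $A$. Then $\mathrm{comp}(y)\subseteq\mathrm{comp}(x)$ if and only if, regarding both $r=x\circ y^{ -1}:y(A)\to\mathbb{T}$ and the identity $\mathrm{id}_{y(A)}:y(A)\to\mathbb{T}$ as representations of the set $y(A)$, one has $\mathrm{comp}(\mathrm{id}_{y(A)})\subseteq\mathrm{comp}(r)$.
   Context: $\mathbb{T}$ denotes the set of tapes over a fixed finite alphabet with finitely many non-blank symbols. For $Q\subseteq\mathbb{T}$, a function with domain $Q$ and values in $\mathbb{T}$ is computable if some Turing machine, on every input $\tau\in Q$, halts with output equal to the function's value (nothing is required outside $Q$). A representation of a set $S$ is an injective function $s:S\to\mathbb{T}$. For a representation $s$ of $S$, $\mathrm{comp}(s)$ is the set of functions $g$ with domain $S$ and values in $S$ such that $s\circ g\circ s^{ -1}$ (defined on $s(S)$) is computable. When $S\subseteq\mathbb{T}$ is itself a set of tapes, an injective map $S\to\mathbb{T}$ (such as $x\circ y^{ -1}$ on $S=y(A)$, or the identity of $S$) is called an endorepresentation and $\mathrm{comp}$ is defined for it in the same way. -}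

module Defs where

open import Data.Nat using (ℕ; zero; suc)
open import Data.Fin using (Fin; zero; suc)
open import Data.Bool using (Bool; true; false; not; T; _∧_)
open import Data.List using (List; []; _∷_; reverse; dropWhile)
open import Data.Maybe using (Maybe; just; nothing)
open import Data.Product using (Σ; _×_; _,_; proj₁; proj₂; ∃-syntax)
open import Relation.Binary.PropositionalEquality using (_≡_)
open import Function.Definitions using (Injective)

Sym : ℕ → Set
Sym k = Fin (suc k)

blank : ∀ {k} → Sym k
blank = zero

isBlank : ∀ {k} → Sym k → Bool
isBlank zero    = true
isBlank (suc _) = false

canon : ∀ {k} → List (Sym k) → Bool
canon []           = true
canon (a ∷ [])     = not (isBlank a)
canon (a ∷ b ∷ as) = canon (b ∷ as)

dropBlanks : ∀ {k} → List (Sym k) → List (Sym k)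
dropBlanks []       = []
dropBlanks (a ∷ as) with isBlank a
... | true  = dropBlanks as
... | false = a ∷ as

normalize : ∀ {k} → List (Sym k) → List (Sym k)
normalize xs = reverse (dropBlanks (reverse xs))

-- A tape is given by the cells
-- left of position 0 (nearest first) and the cells from position 0
-- rightwards, each list without trailing blanks (canonical form, so that
-- propositional equality of tapes is equality of tape contents).

Tape : ℕ → Set
Tape k = Σ (List (Sym k) × List (Sym k)) λ p → T (canon (proj₁ p) ∧ canon (proj₂ p))

-- Turing machines (one tape, states Fin (suc m), start state zero).
-- δ q a = nothing means: halt.

data Move : Set where
  left right : Move

record TM (k : ℕ) : Set where
  field
    m : ℕ
    δ : Fin (suc m) → Sym k → Maybe (Fin (suc m) × Sym k × Move)

record Config (k m : ℕ) : Set where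
  constructor cfg
  field
    state : Fin (suc m)
    lefts : List (Sym k)   -- cells left of the head, nearest first
    rights : List (Sym k)  -- the cell under the head and those to its right

read : ∀ {k} → List (Sym k) → Sym k
read []      = blank
read (a ∷ _) = a

write : ∀ {k} → Sym k → List (Sym k) → List (Sym k)
write s []       = s ∷ []
write s (_ ∷ as) = s ∷ as

moveHead : ∀ {k} → Move → List (Sym k) → List (Sym k) → List (Sym k) × List (Sym k)
moveHead left  []       rs       = [] , blank ∷ rs
moveHead left  (a ∷ ls) rs       = ls , a ∷ rs
moveHead right ls       []       = blank ∷ ls , []
moveHead right ls       (a ∷ rs) = a ∷ ls , rs

step : ∀ {k} (M : TM k) → Config k (TM.m M) → Config k (TM.m M)
step M (cfg q ls rs) with TM.δ M q (read rs)
... | nothing = cfg q ls rs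
... | just (q' , s , d) = cfg q' (proj₁ (moveHead d ls (write s rs)))
                                 (proj₂ (moveHead d ls (write s rs)))

run : ∀ {k} (M : TM k) → ℕ → Config k (TM.m M) → Config k (TM.m M)
run M zero    c = c
run M (suc n) c = run M n (step M c)

initial : ∀ {k} (M : TM k) → Tape k → Config k (TM.m M)
initial M ((ls , rs) , _) = cfg zero ls rs

IsHalted : ∀ {k} (M : TM k) → Config k (TM.m M) → Set
IsHalted M (cfg q ls rs) = TM.δ M q (read rs) ≡ nothing

HasTape : ∀ {k m} → Config k m → Tape k → Set
HasTape (cfg q ls rs) ((ls' , rs') , _) = (normalize ls ≡ ls') × (normalize rs ≡ rs')

HaltsWith : ∀ {k} → TM k → Tape k → Tape k → Set
HaltsWith M τ τ' = ∃[ n ] (IsHalted M (run M n (initial M τ)) × HasTape (run M n (initial M τ)) τ')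

Representation : ∀ {k} → Set → Set
Representation {k} S = Σ (S → Tape k) (Injective _≡_ _≡_)

-- g ∈ comp(s)  :⇔  s ∘ g ∘ s⁻¹ (on s(S)) is computable, i.e. some TM on
-- every input s(a) halts with output s(g(a)).
InComp : ∀ {k} {S : Set} → (S → Tape k) → (S → S) → Set
InComp {k} {S} s g = ∃[ M ] (∀ (a : S) → HaltsWith {k} M (s a) (s (g a)))

CompSubset : ∀ {k} {S : Set} → (S → Tape k) → (S → Tape k) → Set
CompSubset {k} {S} s s' = ∀ (g : S → S) → InComp {k} s g → InComp {k} s' g

Countable : Set → Set
Countable A = ∃[ f ] Injective {A = A} {B = ℕ} _≡_ _≡_ f

Image : ∀ {k} {A : Set} → (A → Tape k) → Set
Image {k} {A} y = Σ (Tape k) λ t → ∃[ a ] y a ≡ t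

idImage : ∀ {k} {A : Set} (y : A → Tape k) → Image y → Tape k
idImage y = proj₁

xAfterYInv : ∀ {k} {A : Set} (x y : A → Tape k) → Image y → Tape k
xAfterYInv x y (t , a , _) = x a

-- Transfer of comp along the parametrisation of the image y(A).
--
-- An element of y(A) is a tape t together with a preimage a and a proof
-- y a ≡ t, so every element is (propositionally) the canonical point
-- point a = (y a , a , refl).  Hence self-maps of A and self-maps of y(A)
-- correspond: a map g on y(A) restricts to A by reading off the preimage
-- of g (point a), and a map f on A extends to y(A) by sending p to the
-- point of f (preimage p).  Restricting an extension is the identity
-- definitionally, and extending a restriction agrees with the original map.
--
-- For a representation ρ of y(A), a map g is in comp(ρ) iff its restriction
-- is in comp(ρ ∘ point): both say that one machine maps ρ(point a) to
-- ρ(g (point a)) for all a.  Consequently comp(ρ) ⊆ comp(σ) iff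
-- comp(ρ ∘ point) ⊆ comp(σ ∘ point).  Theorem 7 is the instance
-- ρ = id_{y(A)}, σ = x ∘ y⁻¹, for which ρ ∘ point = y and σ ∘ point = x
-- hold by definition.
module Submission where

open import Defs
open import Data.Nat using (ℕ)
open import Data.Product using (_×_; _,_; proj₁; proj₂)
open import Function using (_∘_)
open import Function.Definitions using (Injective)
open import Relation.Binary.PropositionalEquality using (_≡_; refl; sym; cong; subst)

InComp-resp : ∀ {k} {S : Set} (s : S → Tape k) {g h : S → S} →
              (∀ a → s (g a) ≡ s (h a)) → InComp s g → InComp s h
InComp-resp s g≈h (M , halts) =
  M , λ a → subst (HaltsWith M (s a)) (g≈h a) (halts a)

module _ {k : ℕ} {A : Set} (y : A → Tape k) where

  point : A → Image y
  point a = y a , a , refl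

  preimage : Image y → A
  preimage (_ , a , _) = a

  point-preimage : ∀ p → point (preimage p) ≡ p
  point-preimage (_ , _ , refl) = refl

  restrict : (Image y → Image y) → A → A
  restrict g = preimage ∘ g ∘ point

  extend : (A → A) → Image y → Image y
  extend f = point ∘ f ∘ preimage

  extend-restrict : ∀ g p → extend (restrict g) p ≡ g p
  extend-restrict g (_ , a , refl) = point-preimage (g (point a))

  module _ (ρ : Image y → Tape k) where

    InComp-restrict : ∀ g → InComp ρ g → InComp (ρ ∘ point) (restrict g)
    InComp-restrict g (M , halts) =
      M , λ a → subst (HaltsWith M (ρ (point a)))
                      (cong ρ (sym (point-preimage (g (point a)))))
                      (halts (point a))

    InComp-extend : ∀ f → InComp (ρ ∘ point) f → InComp ρ (extend f)
    InComp-extend f (M , halts) = M , λ { (_ , a , refl) → halts a }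

    InComp-unrestrict : ∀ g → InComp (ρ ∘ point) (restrict g) → InComp ρ g
    InComp-unrestrict g c =
      InComp-resp ρ (cong ρ ∘ extend-restrict g) (InComp-extend (restrict g) c)

  CompSubset-fromImage : (ρ σ : Image y → Tape k) →
    CompSubset ρ σ → CompSubset (ρ ∘ point) (σ ∘ point)
  CompSubset-fromImage ρ σ ρ⊆σ f c =
    InComp-restrict σ (extend f) (ρ⊆σ (extend f) (InComp-extend ρ f c))

  CompSubset-toImage : (ρ σ : Image y → Tape k) →
    CompSubset (ρ ∘ point) (σ ∘ point) → CompSubset ρ σ
  CompSubset-toImage ρ σ ρ⊆σ g c =
    InComp-unrestrict σ g (ρ⊆σ (restrict g) (InComp-restrict ρ g c))

-- Theorem 7: along point, id_{y(A)} becomes y and x ∘ y⁻¹ becomes x.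
theorem7 : (k : ℕ) (A : Set) → Countable A →
    (x y : A → Tape k) → Injective _≡_ _≡_ x → Injective _≡_ _≡_ y →
    (CompSubset y x → CompSubset (idImage y) (xAfterYInv x y))
    × (CompSubset (idImage y) (xAfterYInv x y) → CompSubset y x)
theorem7 k A _ x y _ _ =
    CompSubset-toImage y (idImage y) (xAfterYInv x y)
  , CompSubset-fromImage y (idImage y) (xAfterYInv x y)
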